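{- Let $\alpha=(\alpha_1,\dots,\alpha_k)$ be a composition of $n$, and let $T_\alpha$ be the standard reversetableau constructed as follows: form the left-justified array whose $i$-th row from the bottom ($1\le i\le k$) contains the integers $\alpha_1+\dots+\alpha_{i-1}+1,\dots,\alpha_1+\dots+\alpha_i$ in decreasing order from left to right, and then move every cell as far up (north) as possible within its column. Then the augmented filling produced from $T_\alpha$ by the algorithm defining $\rho^{ -1}$ (before deleting the basement) is the SSAF with basement $1,\dots,n$ whose only nonempty rows are: row $\alpha_1$, containing $\alpha_1,\alpha_1-1,\dots,1$; row $\alpha_1+\alpha_2$, containing $\alpha_1+\alpha_2,\dots,\alpha_1+1$; and in general row $\alpha_1+\dots+\alpha_i$, containing $\alpha_1+\dots+\alpha_i,\dots,\alpha_1+\dots+\alpha_{i-1}+1$ (each in decreasing order from left to right). Equivalently, $\rho^{ -1}(T_\alpha)$ is the ComT whose row $i$ contains $\alpha_1+\dots+\alpha_{i-1}+1,\dots,\alpha_1+\dots+\alpha_i$ for each $i=1,\dots,k$.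
   Context: Reversetableaux. For a partition $\lambda$, a reversetableau of shape $\lambda$ is a filling of the top-left justified Ferrers diagram of $\lambda$ (row $i$ from the top has $\lambda_i$ cells) by positive integers whose rows weakly decrease left to right and whose columns strictly decrease top to bottom; it is standard if its $N$ cells contain $1,\dots,N$ once each. An augmented diagram with basement of $n$ rows consists of basement cells $(i,0)$, $1\le i\le n$ (row $i$ from the top, column $0$), with cell $(i,0)$ containing $i$, together with cells $(i,j)$, $1\le j\le \gamma_i$, for a weak composition $\gamma=(\gamma_1,\dots,\gamma_n)$. The map $\rho^{ -1}$. Given a reversetableau $T$ with maximum entry $n$, build an augmented filling $F$: start with a basement of $n$ rows and no other cells; for $k=1,2,\dots$ in turn, take the entries of column $k$ of $T$ from top to bottom and place each in column $k$ of $F$, in the highest row $i$ such that cell $(i,k)$ is not yet filled, cell $(i,k-1)$ is filled (possibly a basement cell), and the entry is at most the entry of $(i,k-1)$. $\rho^{ -1}(T)$ denotes the composition tableau (ComT) obtained from $F$ by deleting the basement column and the empty rows. A ComT of shape a composition $\alpha=(\alpha_1,\dots,\alpha_\ell)$ with largest part $m$ is a filling of the left-justified diagram with $\alpha_i$ cells in row $i$ by positive integers with rows weakly decreasing, leftmost column strictly increasing top to bottom, and such that, padding rows with $0$'s to an $\ell\times m$ array $\hat T$, for $1\le i<j\le\ell$, $2\le k\le m$: $\hat T(j,k)\ne0$ and $\hat T(j,k)\ge\hat T(i,k)$ imply $\hat T(j,k)>\hat T(i,k-1)$. An SSAF is as usual a semistandard augmented filling (non-attacking, rows weakly decreasing,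 all type A and B triples inversion triples). -}

module Defs where

open import Data.Nat using (ℕ; zero; suc; _+_; _∸_; _≤_; _<_; _⊔_; _≤ᵇ_; _≡ᵇ_)
open import Data.Bool using (Bool; true; false; _∧_; if_then_else_)
open import Data.List using (List; []; _∷_; _++_; [_]; map; concat; concatMap; foldr; length; replicate; upTo; downFrom; reverse; filter; sum)
open import Data.List.Relation.Unary.All using (All)
open import Data.Maybe using (Maybe; just; nothing)
open import Relation.Binary.PropositionalEquality using (_≡_)
open import Relation.Nullary using (¬_)
import Data.List.Relation.Unary.Any as Any
open import Data.Product using (_×_)

IsComposition : List ℕ → Set
IsComposition α = All (λ a → 1 ≤ a) α

block : ℕ → ℕ → List ℕ
block o a = map (λ j → o + suc j) (downFrom a)

blocksFrom : ℕ → List ℕ → List (List ℕ)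
blocksFrom o [] = []
blocksFrom o (a ∷ α) = block o a ∷ blocksFrom (o + a) α

-- Fillings are represented by lists.
-- A tableau (reversetableau) is given by its list of COLUMNS, each
-- column listed top to bottom.

nth : ℕ → List ℕ → List ℕ
nth k [] = []
nth zero (x ∷ xs) = [ x ]
nth (suc k) (x ∷ xs) = nth k xs

maxList : List ℕ → ℕ
maxList = foldr _⊔_ 0

-- Given a left-justified array by its rows (top to bottom), move every
-- cell as far north as possible within its column; the result is given
-- by its columns (top to bottom).  Column j of the result consists of
-- the cells of column j of the array, in their top-to-bottom order.
moveUp : List (List ℕ) → List (List ℕ)
moveUp rows = map (λ j → concatMap (nth j) rows) (upTo (maxList (map length rows)))

-- The tableau T_α: row i from the bottom is block (α₁+…+α_{i-1}) α_i,
-- so rows from the top are the reverse of blocksFrom 0 α; then move up.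
Tα : List ℕ → List (List ℕ)
Tα α = moveUp (reverse (blocksFrom 0 α))

-- Augmented fillings with basement of n rows: a list of n rows (row i,
-- 1-based, from the top); row i lists the entries of cells
-- (i,1),(i,2),…,(i,γ_i).  The basement cell (i,0) holds i implicitly.

-- entry in the last filled cell of row i (the basement value i if the
-- row has no non-basement cells)
lastOr : ℕ → List ℕ → ℕ
lastOr d [] = d
lastOr d (x ∷ xs) = lastOr x xs

-- Place entry x in column k = suc k₁: in the highest row i such that
-- (i,k) is empty, (i,k-1) is filled (i.e. the row has exactly k-1
-- non-basement cells) and x ≤ entry of (i,k-1).  `i` is the 1-based
-- index of the first row of the given list.
place : ℕ → ℕ → ℕ → List (List ℕ) → Maybe (List (List ℕ))
place k₁ x i [] = nothing
place k₁ x i (r ∷ rs) =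
  if (length r ≡ᵇ k₁) ∧ (x ≤ᵇ lastOr i r)
  then just ((r ++ [ x ]) ∷ rs)
  else Data.Maybe.map (r ∷_) (place k₁ x (suc i) rs)

placeColumn : ℕ → List ℕ → List (List ℕ) → Maybe (List (List ℕ))
placeColumn k₁ [] F = just F
placeColumn k₁ (x ∷ xs) F with place k₁ x 1 F
... | nothing = nothing
... | just F′ = placeColumn k₁ xs F′

placeColumns : ℕ → List (List ℕ) → List (List ℕ) → Maybe (List (List ℕ))
placeColumns k₁ [] F = just F
placeColumns k₁ (c ∷ cs) F with placeColumn k₁ c F
... | nothing = nothing
... | just F′ = placeColumns (suc k₁) cs F′

maxEntry : List (List ℕ) → ℕ
maxEntry T = maxList (concat T)

ρ⁻¹-filling : List (List ℕ) → Maybe (List (List ℕ))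
ρ⁻¹-filling T = placeColumns 0 T (replicate (maxEntry T) [])

isNonEmpty : List ℕ → Bool
isNonEmpty [] = false
isNonEmpty (_ ∷ _) = true

deleteBasement : List (List ℕ) → List (List ℕ)
deleteBasement [] = []
deleteBasement (r ∷ rs) = if isNonEmpty r then r ∷ deleteBasement rs else deleteBasement rs

ρ⁻¹ : List (List ℕ) → Maybe (List (List ℕ))
ρ⁻¹ T = Data.Maybe.map deleteBasement (ρ⁻¹-filling T)

expectedFrom : ℕ → List ℕ → List (List ℕ)
expectedFrom o [] = []
expectedFrom o (a ∷ α) = replicate (a ∸ 1) [] ++ block o a ∷ expectedFrom (o + a) α

expectedFilling : List ℕ → List (List ℕ)
expectedFilling α = expectedFrom 0 α

expectedComT : List ℕ → List (List ℕ)
expectedComT α = blocksFrom 0 α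

-- Composition tableaux (rows listed top to bottom).

-- padded entry T̂(i,k), 1-based i and k; 0 outside the diagram
entryRow : List ℕ → ℕ → ℕ
entryRow [] k = 0
entryRow (x ∷ xs) zero = 0
entryRow (x ∷ xs) (suc zero) = x
entryRow (x ∷ xs) (suc (suc k)) = entryRow xs (suc k)

hat : List (List ℕ) → ℕ → ℕ → ℕ
hat [] i k = 0
hat (r ∷ rs) zero k = 0
hat (r ∷ rs) (suc zero) k = entryRow r k
hat (r ∷ rs) (suc (suc i)) k = hat rs (suc i) k

data WeaklyDecreasing : List ℕ → Set where
  wd[] : WeaklyDecreasing []
  wd[x] : ∀ {x} → WeaklyDecreasing [ x ]
  wd∷ : ∀ {x y xs} → y ≤ x → WeaklyDecreasing (y ∷ xs) → WeaklyDecreasing (x ∷ y ∷ xs)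

record IsComT (T : List (List ℕ)) : Set where
  field
    rowsNonEmpty   : All (λ r → 1 ≤ length r) T
    entriesPos     : All (All (λ x → 1 ≤ x)) T
    rowsDecreasing : All WeaklyDecreasing T
    firstColIncr   : ∀ i j → 1 ≤ i → i < j → j ≤ length T → hat T i 1 < hat T j 1
    triple         : ∀ i j k → 1 ≤ i → i < j → j ≤ length T →
                     2 ≤ k → k ≤ maxList (map length T) →
                     ¬ (hat T j k ≡ 0) → hat T i k ≤ hat T j k →
                     hat T i (k ∸ 1) < hat T j k

module Submission where

-- Write s_i = α₁+…+α_i.  Block i of T_α holds s_i, s_i - 1, …, s_{i-1}+1;
-- the rows of T_α, top to bottom, are the blocks from last to first, and
-- column j+1 of T_α lists the (j+1)-st entries of the blocks, last block
-- first.  The invariant of the algorithm is that after j columns the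
-- filling is `expectedUpTo j 0 α`: row s_i holds the first j entries of
-- block i and every other row is empty.  Placing column j+1 extends it:
-- when the (j+1)-st entry s_{i-1}+1+d of block i is placed, every row
-- above s_{i-1} holds entries ≤ s_{i-1} (and has index ≤ s_{i-1}), the
-- rows strictly between s_{i-1} and s_i are empty (of the wrong length
-- unless j = 0, when their index is too small), so the entry lands at the
-- end of row s_i.  The array T_α has max entry n = sum α and width
-- max α, so the algorithm starts from n empty rows and stops with the
-- full expected filling.  Deleting the empty rows gives the blocks, which
-- form a ComT because every entry of a higher row is smaller than every
-- entry of a lower one.

open import Defs
open import Data.Nat using (ℕ; zero; suc; _+_; _∸_; _≤_; _<_; _⊔_; _≤ᵇ_; _≡ᵇ_; z≤n; s≤s; z<s; _≤?_)
open import Data.Nat.Properties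
open import Data.Bool using (true; false; _∧_; T)
open import Data.Bool.Properties using (∧-zeroʳ; T-≡)
open import Data.List using (List; []; _∷_; _++_; [_]; map; concatMap; length; replicate; reverse; applyUpTo; take; initLast; _∷ʳ′_)
open import Data.List.Properties using (++-assoc; ++-identityʳ; unfold-reverse; reverse-++; concatMap-++; map-upTo; take-all; length-++; length-replicate)
open import Data.Nat.ListAction using (sum)
open import Data.Nat.ListAction.Properties using (sum-++)
open import Data.List.Relation.Unary.All using (All; []; _∷_)
import Data.List.Relation.Unary.All as All
open import Data.List.Relation.Unary.All.Properties using (++⁺; ++⁻; concat⁺; map⁺; map⁻; take⁺; replicate⁺; applyUpTo⁺₂)
open import Data.List.Relation.Binary.Permutation.Propositional using (↭-sym)
open import Data.List.Relation.Binary.Permutation.Propositional.Properties using (All-resp-↭; ↭-reverse)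
open import Data.Maybe using (just)
import Data.Maybe
open import Data.Product using (_×_; _,_; proj₁; proj₂)
open import Data.Sum using (_⊎_; inj₁; inj₂)
open import Data.Unit using (⊤; tt)
open import Data.Empty using (⊥-elim)
open import Function.Bundles using (Equivalence)
open import Relation.Binary.PropositionalEquality using (_≡_; refl; sym; trans; cong; cong₂; subst; module ≡-Reasoning)
open import Relation.Nullary using (¬_; yes; no)

maxList-lub : ∀ {b} xs → All (_≤ b) xs → maxList xs ≤ b
maxList-lub [] [] = z≤n
maxList-lub (x ∷ xs) (p ∷ ps) = ⊔-lub p (maxList-lub xs ps)

maxList-ub : ∀ xs → All (_≤ maxList xs) xs
maxList-ub [] = []
maxList-ub (x ∷ xs) = m≤m⊔n x _ ∷ All.map (λ p → ≤-trans p (m≤n⊔m x _)) (maxList-ub xs)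

maxList-++ : ∀ xs ys → maxList xs ≤ maxList (xs ++ ys)
maxList-++ [] ys = z≤n
maxList-++ (x ∷ xs) ys = ⊔-monoʳ-≤ x (maxList-++ xs ys)

lastOr-All : ∀ {Q : ℕ → Set} i r → Q i → All Q r → Q (lastOr i r)
lastOr-All i [] qi [] = qi
lastOr-All i (x ∷ r) qi (qx ∷ qr) = lastOr-All x r qx qr

nth-All : ∀ {Q : ℕ → Set} j r → All Q r → All Q (nth j r)
nth-All j [] _ = []
nth-All zero (x ∷ r) (q ∷ _) = q ∷ []
nth-All (suc j) (x ∷ r) (_ ∷ qs) = nth-All j r qs

nth-short : ∀ j (l : List ℕ) → length l ≤ j → nth j l ≡ []
nth-short j [] _ = refl
nth-short (suc j) (x ∷ l) (s≤s p) = nth-short j l p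

entryRow-All : ∀ {Q : ℕ → Set} r k → Q 0 → All Q r → Q (entryRow r k)
entryRow-All [] k q0 _ = q0
entryRow-All (x ∷ r) zero q0 _ = q0
entryRow-All (x ∷ r) (suc zero) q0 (qx ∷ _) = qx
entryRow-All (x ∷ r) (suc (suc k)) q0 (_ ∷ qs) = entryRow-All r (suc k) q0 qs

All-reverse : ∀ {A : Set} {Q : A → Set} (xs : List A) → All Q xs → All Q (reverse xs)
All-reverse xs = All-resp-↭ (↭-sym (↭-reverse xs))

replicate-+ : ∀ {A : Set} m n (x : A) → replicate (m + n) x ≡ replicate m x ++ replicate n x
replicate-+ zero n x = refl
replicate-+ (suc m) n x = cong (x ∷_) (replicate-+ m n x)

regroup : ∀ {A : Set} (P Q : List A) r X → P ++ Q ++ r ∷ X ≡ (P ++ Q ++ [ r ]) ++ X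
regroup P Q r X = trans (cong (P ++_) (sym (++-assoc Q [ r ] X))) (sym (++-assoc P (Q ++ [ r ]) X))

≤ᵇ-true : ∀ {x y} → x ≤ y → (x ≤ᵇ y) ≡ true
≤ᵇ-true p = Equivalence.to T-≡ (≤⇒≤ᵇ p)

≤ᵇ-false : ∀ x y → y < x → (x ≤ᵇ y) ≡ false
≤ᵇ-false x y y<x with x ≤ᵇ y in eq
... | false = refl
... | true = ⊥-elim (<⇒≱ y<x (≤ᵇ⇒≤ x y (subst T (sym eq) tt)))

≡ᵇ-true : ∀ {m n} → m ≡ n → (m ≡ᵇ n) ≡ true
≡ᵇ-true {m} {n} eq = Equivalence.to T-≡ (≡⇒≡ᵇ m n eq)

block-length : ∀ o a → length (block o a) ≡ a
block-length o zero = refl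
block-length o (suc a) = cong suc (block-length o a)

block-fits : ∀ o {a j} → a ≤ j → length (block o a) ≤ j
block-fits o {a} = ≤-trans (≤-reflexive (block-length o a))

block-range : ∀ o a → All (λ y → o < y × y ≤ o + a) (block o a)
block-range o zero = []
block-range o (suc a) = (m<m+n o z<s , ≤-refl)
  ∷ All.map (λ { (p , q) → p , ≤-trans q (+-monoʳ-≤ o (n≤1+n a)) }) (block-range o a)

block-decreasing : ∀ o a → WeaklyDecreasing (block o a)
block-decreasing o zero = wd[]
block-decreasing o (suc zero) = wd[x]
block-decreasing o (suc (suc a)) = wd∷ (+-monoʳ-≤ o (n≤1+n (suc a))) (block-decreasing o (suc a))

nth-block : ∀ j o d → nth j (block o (suc (j + d))) ≡ [ o + suc d ]
nth-block zero o d = refl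
nth-block (suc j) o d = nth-block j o d

take-block-length : ∀ j o d → length (take j (block o (suc (j + d)))) ≡ j
take-block-length zero o d = refl
take-block-length (suc j) o d = cong suc (take-block-length j o d)

take-block-last : ∀ i j o d → o + suc d ≤ i → o + suc d ≤ lastOr i (take j (block o (suc (j + d))))
take-block-last i zero o d p = p
take-block-last i (suc j) o d p =
  take-block-last _ j o d (+-monoʳ-≤ o (s≤s (≤-trans (m≤n+m d j) (n≤1+n _))))

take-block-snoc : ∀ j o d → take j (block o (suc (j + d))) ++ [ o + suc d ] ≡ take (suc j) (block o (suc (j + d)))
take-block-snoc zero o d = refl
take-block-snoc (suc j) o d = cong (o + suc (suc (j + d)) ∷_) (take-block-snoc j o d)

blocksFrom-++ : ∀ o β γ → blocksFrom o (β ++ γ) ≡ blocksFrom o β ++ blocksFrom (o + sum β) γ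
blocksFrom-++ o [] γ = cong (λ z → blocksFrom z γ) (sym (+-identityʳ o))
blocksFrom-++ o (a ∷ β) γ rewrite blocksFrom-++ (o + a) β γ | +-assoc o a (sum β) = refl

blocks-bounded : ∀ o α → All (All (_≤ o + sum α)) (blocksFrom o α)
blocks-bounded o [] = []
blocks-bounded o (a ∷ α) = All.map (λ p → ≤-trans (proj₂ p) (+-monoʳ-≤ o (m≤m+n a (sum α)))) (block-range o a)
  ∷ All.map (All.map (λ p → ≤-trans p (≤-reflexive (+-assoc o a (sum α))))) (blocks-bounded (o + a) α)

parts-from-blocks : ∀ {Q : ℕ → Set} o α → All (λ r → Q (length r)) (blocksFrom o α) → All Q α
parts-from-blocks o [] [] = []
parts-from-blocks {Q} o (a ∷ α) (q ∷ qs) = subst Q (block-length o a) q ∷ parts-from-blocks (o + a) α qs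

column : ℕ → List (List ℕ) → List ℕ
column j rows = concatMap (nth j) rows

-- The block of the first part is the bottom row, so it is read last.
column-blocks-cons : ∀ j o a α →
  column j (reverse (blocksFrom o (a ∷ α))) ≡ column j (reverse (blocksFrom (o + a) α)) ++ nth j (block o a)
column-blocks-cons j o a α = begin
  column j (reverse (block o a ∷ blocksFrom (o + a) α))
    ≡⟨ cong (column j) (unfold-reverse (block o a) (blocksFrom (o + a) α)) ⟩
  column j (reverse (blocksFrom (o + a) α) ++ [ block o a ])
    ≡⟨ concatMap-++ (nth j) (reverse (blocksFrom (o + a) α)) [ block o a ] ⟩
  column j (reverse (blocksFrom (o + a) α)) ++ nth j (block o a) ++ []
    ≡⟨ cong (column j (reverse (blocksFrom (o + a) α)) ++_) (++-identityʳ (nth j (block o a))) ⟩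
  column j (reverse (blocksFrom (o + a) α)) ++ nth j (block o a) ∎
  where open ≡-Reasoning

moveUp-All : ∀ {Q : ℕ → Set} rows → All (All Q) rows → All (All Q) (moveUp rows)
moveUp-All rows q = map⁺ (applyUpTo⁺₂ _ _ (λ j → concat⁺ (map⁺ (All.map (λ {r} → nth-All j r) q))))

-- … and the top-left entry lands in the first column (the width is
-- positive, so column 1 is present and starts with x).
moveUp-topLeft : ∀ x xs rs → x ≤ maxEntry (moveUp ((x ∷ xs) ∷ rs))
moveUp-topLeft x xs rs with suc (length xs) ⊔ maxList (map length rs) | m≤m⊔n (suc (length xs)) (maxList (map length rs))
... | zero | ()
... | suc w | _ = ≤-trans (m≤m⊔n x _) (maxList-++ (column 0 ((x ∷ xs) ∷ rs)) _)

-- The entry n = sum α heads the top row of T_α, and bounds all entries.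
maxEntry-Tα : ∀ α → IsComposition α → maxEntry (Tα α) ≡ sum α
maxEntry-Tα α c = ≤-antisym upper (lower α c)
  where
  upper : maxEntry (Tα α) ≤ sum α
  upper = maxList-lub _ (concat⁺ (moveUp-All _ (All-reverse _ (blocks-bounded 0 α))))
  -- The last part a′+1 of α gives the top row of T_α, headed by sum α.
  lower : ∀ α → IsComposition α → sum α ≤ maxEntry (Tα α)
  lower α c with initLast α
  ... | [] = z≤n
  ... | β ∷ʳ′ a with ++⁻ β c
  ... | _ , (s≤s {n = a′} z≤n ∷ []) = begin
    sum (β ++ [ suc a′ ])          ≡⟨ trans (sum-++ β [ suc a′ ]) (cong (sum β +_) (+-identityʳ (suc a′))) ⟩
    sum β + suc a′                 ≤⟨ moveUp-topLeft _ (block (sum β) a′) (reverse (blocksFrom 0 β)) ⟩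
    maxEntry (moveUp (block (sum β) (suc a′) ∷ reverse (blocksFrom 0 β)))
                                   ≡⟨ cong (λ rows → maxEntry (moveUp rows)) (sym top-row) ⟩
    maxEntry (Tα (β ++ [ suc a′ ])) ∎
    where
    open ≤-Reasoning
    top-row : reverse (blocksFrom 0 (β ++ [ suc a′ ])) ≡ block (sum β) (suc a′) ∷ reverse (blocksFrom 0 β)
    top-row = trans (cong reverse (blocksFrom-++ 0 β [ suc a′ ])) (reverse-++ (blocksFrom 0 β) _)

parts-≤-width : ∀ α → All (_≤ maxList (map length (reverse (blocksFrom 0 α)))) α
parts-≤-width α = parts-from-blocks 0 α
  (All-resp-↭ (↭-reverse (blocksFrom 0 α)) (map⁻ (maxList-ub (map length (reverse (blocksFrom 0 α))))))

Rejects : ℕ → ℕ → ℕ → List ℕ → Set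
Rejects k x i r = ((length r ≡ᵇ k) ∧ (x ≤ᵇ lastOr i r)) ≡ false

AllReject : ℕ → ℕ → ℕ → List (List ℕ) → Set
AllReject k x i [] = ⊤
AllReject k x i (r ∷ P) = Rejects k x i r × AllReject k x (suc i) P

place-skip : ∀ {k x i i′} P {R R′} → AllReject k x i P → i + length P ≡ i′ →
  place k x i′ R ≡ just R′ → place k x i (P ++ R) ≡ just (P ++ R′)
place-skip {k} {x} {i} [] {R} {R′} _ eq h = subst (λ m → place k x m R ≡ just R′) (trans (sym eq) (+-identityʳ i)) h
place-skip {i = i} (r ∷ P) (rej , rejs) eq h rewrite rej =
  cong (Data.Maybe.map (r ∷_)) (place-skip P rejs (trans (sym (+-suc i (length P))) eq) h)

place-here : ∀ {k x i r} S → length r ≡ k → x ≤ lastOr i r → place k x i (r ∷ S) ≡ just ((r ++ [ x ]) ∷ S)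
place-here S len≡ x≤ rewrite ≡ᵇ-true len≡ | ≤ᵇ-true x≤ = refl

allReject-below : ∀ {k x} i P → All (All (_< x)) P → i + length P ≤ x → AllReject k x i P
allReject-below i [] _ _ = tt
allReject-below {k} {x} i (r ∷ P) (q ∷ qs) bound =
  trans (cong ((length r ≡ᵇ k) ∧_) (≤ᵇ-false x _ (lastOr-All i r i<x q))) (∧-zeroʳ _)
  , allReject-below (suc i) P qs bound′
  where
  bound′ : suc i + length P ≤ x
  bound′ = ≤-trans (≤-reflexive (sym (+-suc i (length P)))) bound
  i<x : i < x
  i<x = ≤-trans (m≤m+n (suc i) (length P)) bound′

allReject-empty : ∀ {k x} i m → AllReject (suc k) x i (replicate m [])
allReject-empty i zero = tt
allReject-empty i (suc m) = refl , allReject-empty (suc i) m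

placeColumn-single : ∀ k x F {F′} → place k x 1 F ≡ just F′ → placeColumn k [ x ] F ≡ just F′
placeColumn-single k x F eq rewrite eq = refl

placeColumn-++ : ∀ k xs ys F {F′} → placeColumn k xs F ≡ just F′ → placeColumn k (xs ++ ys) F ≡ placeColumn k ys F′
placeColumn-++ k [] ys F refl = refl
placeColumn-++ k (x ∷ xs) ys F eq with place k x 1 F
... | just F₁ = placeColumn-++ k xs ys F₁ eq

placeColumns-cons : ∀ k c cs F {F′} → placeColumn k c F ≡ just F′ → placeColumns k (c ∷ cs) F ≡ placeColumns (suc k) cs F′
placeColumns-cons k c cs F eq rewrite eq = refl

placeColumns-run : ∀ (G : ℕ → List (List ℕ)) (cols : ℕ → List ℕ) k →
  (∀ i → placeColumn (k + i) (cols i) (G i) ≡ just (G (suc i))) →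
  ∀ t → placeColumns k (applyUpTo cols t) (G 0) ≡ just (G t)
placeColumns-run G cols k step zero = refl
placeColumns-run G cols k step (suc t) =
  trans (placeColumns-cons k (cols 0) (applyUpTo (λ i → cols (suc i)) t) (G 0) (subst (λ m → placeColumn m (cols 0) (G 0) ≡ just (G 1)) (+-identityʳ k) (step 0)))
        (placeColumns-run (λ i → G (suc i)) (λ i → cols (suc i)) (suc k) step′ t)
  where
  step′ : ∀ i → placeColumn (suc k + i) (cols (suc i)) (G (suc i)) ≡ just (G (suc (suc i)))
  step′ i = subst (λ m → placeColumn m (cols (suc i)) (G (suc i)) ≡ just (G (suc (suc i)))) (+-suc k i) (step (suc i))

-- The invariant of the algorithm

expectedUpTo : ℕ → ℕ → List ℕ → List (List ℕ)
expectedUpTo j o [] = []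
expectedUpTo j o (a ∷ α) = replicate (a ∸ 1) [] ++ take j (block o a) ∷ expectedUpTo j (o + a) α

expectedUpTo-zero : ∀ o α → IsComposition α → expectedUpTo 0 o α ≡ replicate (sum α) []
expectedUpTo-zero o [] _ = refl
expectedUpTo-zero o (suc a ∷ α) (_ ∷ c) = begin
  replicate a [] ++ [] ∷ expectedUpTo 0 (o + suc a) α
    ≡⟨ cong (λ X → replicate a [] ++ [] ∷ X) (expectedUpTo-zero (o + suc a) α c) ⟩
  replicate a [] ++ replicate (suc (sum α)) []
    ≡⟨ sym (replicate-+ a (suc (sum α)) []) ⟩
  replicate (a + suc (sum α)) []
    ≡⟨ cong (λ m → replicate m []) (+-suc a (sum α)) ⟩
  replicate (suc a + sum α) [] ∎
  where open ≡-Reasoning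

expectedUpTo-full : ∀ m o α → All (_≤ m) α → expectedUpTo m o α ≡ expectedFrom o α
expectedUpTo-full m o [] _ = refl
expectedUpTo-full m o (a ∷ α) (p ∷ ps)
  rewrite take-all m (block o a) (≤-trans (≤-reflexive (block-length o a)) p) | expectedUpTo-full m (o + a) α ps = refl

record IsPrefix (o : ℕ) (P : List (List ℕ)) : Set where
  field
    length≡ : length P ≡ o
    bounded : All (All (_≤ o)) P

isPrefix-empty : IsPrefix 0 []
isPrefix-empty = record { length≡ = refl ; bounded = [] }

isPrefix-extend : ∀ {o P} j a → IsPrefix o P → 1 ≤ a →
  IsPrefix (o + a) (P ++ replicate (a ∸ 1) [] ++ [ take j (block o a) ])
isPrefix-extend {o} {P} j a pre 1≤a = record
  { length≡ = begin
      length (P ++ replicate (a ∸ 1) [] ++ [ take j (block o a) ])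
        ≡⟨ length-++ P ⟩
      length P + length (replicate (a ∸ 1) [] ++ [ take j (block o a) ])
        ≡⟨ cong₂ _+_ (IsPrefix.length≡ pre) (length-++ (replicate (a ∸ 1) [])) ⟩
      o + (length (replicate (a ∸ 1) []) + 1)
        ≡⟨ cong (λ m → o + (m + 1)) (length-replicate (a ∸ 1)) ⟩
      o + (a ∸ 1 + 1)
        ≡⟨ cong (o +_) (m∸n+n≡m 1≤a) ⟩
      o + a ∎
  ; bounded = ++⁺ (All.map (All.map (λ p → ≤-trans p (m≤m+n o a))) (IsPrefix.bounded pre))
                  (++⁺ (replicate⁺ (a ∸ 1) []) (take⁺ j (All.map proj₂ (block-range o a)) ∷ []))
  }
  where open ≡-Reasoning

place-blockEntry : ∀ j o d P S → IsPrefix o P →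
  place j (o + suc d) 1 (P ++ replicate (j + d) [] ++ take j (block o (suc (j + d))) ∷ S)
  ≡ just (P ++ replicate (j + d) [] ++ (take j (block o (suc (j + d))) ++ [ o + suc d ]) ∷ S)
place-blockEntry j o d P S pre =
  place-skip P (allReject-below 1 P below-x (≤-trans (s≤s (≤-reflexive (IsPrefix.length≡ pre))) o<x))
    (cong suc (IsPrefix.length≡ pre))
    (place-skip (replicate (j + d) []) (emptyRowsReject j) (cong (suc o +_) (length-replicate (j + d)))
      (place-here S (take-block-length j o d)
        (take-block-last _ j o d (≤-trans (≤-reflexive (+-suc o d)) (s≤s (+-monoʳ-≤ o (m≤n+m d j)))))))
  where
  o<x : o < o + suc d
  o<x = m<m+n o z<s
  below-x : All (All (_< o + suc d)) P
  below-x = All.map (All.map (λ p → ≤-<-trans p o<x)) (IsPrefix.bounded pre)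
  emptyRowsReject : ∀ j → AllReject j (o + suc d) (suc o) (replicate (j + d) [])
  emptyRowsReject zero = allReject-below (suc o) _ (replicate⁺ d [])
    (≤-reflexive (trans (cong (suc o +_) (length-replicate d)) (sym (+-suc o d))))
  emptyRowsReject (suc j) = allReject-empty (suc o) (suc j + d)

placeColumn-blockEntry : ∀ j o a P S → IsPrefix o P →
  placeColumn j (nth j (block o a)) (P ++ replicate (a ∸ 1) [] ++ take j (block o a) ∷ S)
  ≡ just (P ++ replicate (a ∸ 1) [] ++ take (suc j) (block o a) ∷ S)
placeColumn-blockEntry j o a P S pre with a ≤? j
... | yes a≤j
  rewrite nth-short j (block o a) (block-fits o a≤j) | take-all j (block o a) (block-fits o a≤j)
        | take-all (suc j) (block o a) (m≤n⇒m≤1+n (block-fits o a≤j)) = refl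
... | no a≰j with m≤n⇒∃[o]m+o≡n (≰⇒> a≰j)
... | d , refl rewrite nth-block j o d | sym (take-block-snoc j o d) =
  placeColumn-single j (o + suc d) (P ++ replicate (j + d) [] ++ take j (block o (suc (j + d))) ∷ S)
    (place-blockEntry j o d P S pre)

placeColumn-blocks : ∀ j o α P → IsComposition α → IsPrefix o P →
  placeColumn j (column j (reverse (blocksFrom o α))) (P ++ expectedUpTo j o α)
  ≡ just (P ++ expectedUpTo (suc j) o α)
placeColumn-blocks j o [] P _ _ = refl
placeColumn-blocks j o (a ∷ α) P (1≤a ∷ c) pre = begin
  placeColumn j (column j (reverse (blocksFrom o (a ∷ α)))) (P ++ Q ++ row j ∷ expectedUpTo j (o + a) α)
    ≡⟨ cong₂ (placeColumn j) (column-blocks-cons j o a α) (regroup P Q (row j) _) ⟩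
  placeColumn j (column j (reverse (blocksFrom (o + a) α)) ++ nth j (block o a)) (P′ ++ expectedUpTo j (o + a) α)
    ≡⟨ placeColumn-++ j (column j (reverse (blocksFrom (o + a) α))) (nth j (block o a)) _ (placeColumn-blocks j (o + a) α P′ c (isPrefix-extend j a pre 1≤a)) ⟩
  placeColumn j (nth j (block o a)) (P′ ++ expectedUpTo (suc j) (o + a) α)
    ≡⟨ cong (placeColumn j (nth j (block o a))) (sym (regroup P Q (row j) _)) ⟩
  placeColumn j (nth j (block o a)) (P ++ Q ++ row j ∷ expectedUpTo (suc j) (o + a) α)
    ≡⟨ placeColumn-blockEntry j o a P _ pre ⟩
  just (P ++ Q ++ row (suc j) ∷ expectedUpTo (suc j) (o + a) α) ∎
  where
  open ≡-Reasoning
  Q : List (List ℕ)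
  Q = replicate (a ∸ 1) []
  row : ℕ → List ℕ
  row j = take j (block o a)
  P′ : List (List ℕ)
  P′ = P ++ Q ++ [ row j ]

ρ⁻¹-filling-Tα : ∀ α → IsComposition α → ρ⁻¹-filling (Tα α) ≡ just (expectedFilling α)
ρ⁻¹-filling-Tα α c = begin
  placeColumns 0 (Tα α) (replicate (maxEntry (Tα α)) [])
    ≡⟨ cong₂ (placeColumns 0) (map-upTo (λ j → column j rows) width)
             (trans (cong (λ m → replicate m []) (maxEntry-Tα α c)) (sym (expectedUpTo-zero 0 α c))) ⟩
  placeColumns 0 (applyUpTo (λ j → column j rows) width) (expectedUpTo 0 0 α)
    ≡⟨ placeColumns-run (λ j → expectedUpTo j 0 α) (λ j → column j rows) 0
         (λ j → placeColumn-blocks j 0 α [] c isPrefix-empty) width ⟩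
  just (expectedUpTo width 0 α)
    ≡⟨ cong just (expectedUpTo-full width 0 α (parts-≤-width α)) ⟩
  just (expectedFilling α) ∎
  where
  open ≡-Reasoning
  rows : List (List ℕ)
  rows = reverse (blocksFrom 0 α)
  width : ℕ
  width = maxList (map length rows)

deleteBasement-empty : ∀ m X → deleteBasement (replicate m [] ++ X) ≡ deleteBasement X
deleteBasement-empty zero X = refl
deleteBasement-empty (suc m) X = deleteBasement-empty m X

deleteBasement-expected : ∀ o α → IsComposition α → deleteBasement (expectedFrom o α) ≡ blocksFrom o α
deleteBasement-expected o [] _ = refl
deleteBasement-expected o (suc a ∷ α) (_ ∷ c) =
  trans (deleteBasement-empty a _) (cong (block o (suc a) ∷_) (deleteBasement-expected (o + suc a) α c))

-- The blocks form a composition tableau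

hat-upper : ∀ o α i k → hat (blocksFrom o α) i k ≤ o + sum (take i α)
hat-upper o [] i k = z≤n
hat-upper o (a ∷ α) zero k = z≤n
hat-upper o (a ∷ α) (suc zero) k =
  entryRow-All (block o a) k z≤n
    (All.map (λ p → ≤-trans (proj₂ p) (≤-reflexive (cong (o +_) (sym (+-identityʳ a))))) (block-range o a))
hat-upper o (a ∷ α) (suc (suc i)) k = ≤-trans (hat-upper (o + a) α (suc i) k) (≤-reflexive (+-assoc o a _))

hat-lower : ∀ o α i k → ¬ (hat (blocksFrom o α) (suc i) k ≡ 0) → o + sum (take i α) < hat (blocksFrom o α) (suc i) k
hat-lower o [] i k ne = ⊥-elim (ne refl)
hat-lower o (a ∷ α) zero k ne
  with entryRow-All {Q = λ y → y ≡ 0 ⊎ o < y} (block o a) k (inj₁ refl) (All.map (λ p → inj₂ (proj₁ p)) (block-range o a))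
... | inj₁ e = ⊥-elim (ne e)
... | inj₂ p = subst (_< entryRow (block o a) k) (sym (+-identityʳ o)) p
hat-lower o (a ∷ α) (suc i) k ne =
  subst (_< hat (blocksFrom (o + a) α) (suc i) k) (+-assoc o a _) (hat-lower (o + a) α i k ne)

sum-take-mono : ∀ (α : List ℕ) {i j} → i ≤ j → sum (take i α) ≤ sum (take j α)
sum-take-mono [] {zero} _ = z≤n
sum-take-mono [] {suc i} _ = z≤n
sum-take-mono (a ∷ α) {zero} _ = z≤n
sum-take-mono (a ∷ α) {suc i} (s≤s p) = +-monoʳ-≤ a (sum-take-mono α p)

rows-separated : ∀ o α i j k k′ → i < j → ¬ (hat (blocksFrom o α) j k′ ≡ 0) →
  hat (blocksFrom o α) i k < hat (blocksFrom o α) j k′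
rows-separated o α i (suc j) k k′ (s≤s i≤j) ne =
  ≤-<-trans (hat-upper o α i k) (≤-<-trans (+-monoʳ-≤ o (sum-take-mono α i≤j)) (hat-lower o α j k′ ne))

firstColumn-nonzero : ∀ o α j → IsComposition α → suc j ≤ length (blocksFrom o α) → ¬ (hat (blocksFrom o α) (suc j) 1 ≡ 0)
firstColumn-nonzero o (suc a ∷ α) zero _ _ e with trans (sym (+-suc o a)) e
... | ()
firstColumn-nonzero o (a ∷ α) (suc j) (_ ∷ c) (s≤s p) e = firstColumn-nonzero (o + a) α j c p e

-- Rows are nonempty, positive and decreasing; both ComT inequalities
-- follow from the separation of rows.
blocks-isComT : ∀ α → IsComposition α → IsComT (blocksFrom 0 α)
blocks-isComT α c = record
  { rowsNonEmpty = rowsNonEmpty 0 α c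
  ; entriesPos = entriesPos 0 α
  ; rowsDecreasing = rowsDecreasing 0 α
  ; firstColIncr = λ { i (suc j) _ i<j j≤ → rows-separated 0 α i (suc j) 1 1 i<j (firstColumn-nonzero 0 α j c j≤) }
  ; triple = λ i j k _ i<j _ _ _ ne _ → rows-separated 0 α i j (k ∸ 1) k i<j ne
  }
  where
  rowsNonEmpty : ∀ o α → IsComposition α → All (λ r → 1 ≤ length r) (blocksFrom o α)
  rowsNonEmpty o [] _ = []
  rowsNonEmpty o (a ∷ α) (p ∷ c) = subst (1 ≤_) (sym (block-length o a)) p ∷ rowsNonEmpty (o + a) α c
  entriesPos : ∀ o α → All (All (1 ≤_)) (blocksFrom o α)
  entriesPos o [] = []
  entriesPos o (a ∷ α) = All.map (λ p → ≤-trans (s≤s z≤n) (proj₁ p)) (block-range o a) ∷ entriesPos (o + a) α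
  rowsDecreasing : ∀ o α → All WeaklyDecreasing (blocksFrom o α)
  rowsDecreasing o [] = []
  rowsDecreasing o (a ∷ α) = block-decreasing o a ∷ rowsDecreasing (o + a) α

lemma5p5 : (n : ℕ) (α : List ℕ) → IsComposition α → sum α ≡ n →
    (ρ⁻¹-filling (Tα α) ≡ just (expectedFilling α))
    × (ρ⁻¹ (Tα α) ≡ just (expectedComT α))
    × IsComT (expectedComT α)
lemma5p5 n α c _ =
  ρ⁻¹-filling-Tα α c
  , trans (cong (Data.Maybe.map deleteBasement) (ρ⁻¹-filling-Tα α c)) (cong just (deleteBasement-expected 0 α c))
  , blocks-isComT α c
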